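{- Let $k\ge1$, fix monomials $f_{i,\sigma,\tau}(q)\in\mathbb{Z}[q]$ for $1\le i\le k$, $\sigma\ge1$, $\tau\ge0$, and use the weighted $k$-Fibonacci polynomials defined in the context. Then for all integers $m\ge1$ and $n\ge1$, $$F_{m+n}^k(\mathbf z;q)=F_m^k(\mathbf z\mathbf s_n^+;q)\,F_n^k(\mathbf z\mathbf s_m^-;q)+\sum_{i=2}^k\sum_{j=1}^{i-1}z_i\,f_{i,m-j+1,n-i+j}(q)\,F_{m-j}^k(\mathbf z\mathbf s^+_{n+j};q)\,F^k_{n-i+j}(\mathbf z\mathbf s^-_{m+i-j};q).$$
   Context: Cells of an $n\times1$ board are numbered $1,\dots,n$. A tiling of the board by tiles of length at most $k$ is a sequence of tiles of lengths $\ell_1,\dots,\ell_r\in\{1,\dots,k\}$ with $\ell_1+\cdots+\ell_r=n$; the $j$-th tile starts at cell $\sigma_j=1+\ell_1+\cdots+\ell_{j-1}$ and is followed by $\tau_j=n-(\sigma_j+\ell_j-1)$ cells. Let $\mathbf z=(z_1,\dots,z_k)$ be indeterminates. A tile of length $i$ that begins in cell $\sigma$ and is followed by $\tau$ cells has weight $z_i f_{i,\sigma,\tau}(q)$, and the weight of a tiling is the product of the weights of its tiles. For integers $a,b\ge0$ define $$F_n^k[a,b]=\sum \prod_{j=1}^r z_{\ell_j}\,f_{\ell_j,\,a+\sigma_j,\,b+\tau_j}(q),$$ the sum over all tilings of the $n\times1$ board by tiles of length at most $k$ (the weighted count of tilings of an $n\times 1$ board that has an untiled $a\times1$ board appended before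 it and an untiled $b\times1$ board appended after it). By convention $F_0^k[a,b]=1$ and $F_n^k[a,b]=0$ for $n<0$. Notation: $F_n^k(\mathbf z;q)=F_n^k[0,0]$, $F_n^k(\mathbf z\mathbf s^+_m;q)=F_n^k[0,m]$, and $F_n^k(\mathbf z\mathbf s^-_m;q)=F_n^k[m,0]$. -}

module Defs where

open import Level using (Level)
open import Data.Nat using (ℕ; zero; suc; _∸_; _≤?_) renaming (_+_ to _+ℕ_)
open import Data.Integer using (ℤ; +_; -[1+_])
open import Data.Product using (_×_; _,_)
open import Data.List using (List; []; _∷_; map; concatMap; filter; upTo; foldr)
open import Algebra.Bundles using (CommutativeRing)

-- Tilings of an n×1 board by tiles of length at most k, encoded as the list
-- of tile lengths (ℓ₁,…,ℓᵣ) with each ℓⱼ ∈ {1,…,k} and ℓ₁+⋯+ℓᵣ = n.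
-- Enumerated by choosing the first tile; the fuel argument only ensures
-- structural recursion (fuel n suffices, since each tile has length ≥ 1).
tilingsFuel : (k fuel n : ℕ) → List (List ℕ)
tilingsFuel k _        zero    = [] ∷ []
tilingsFuel k zero     (suc n) = []
tilingsFuel k (suc f) (suc n) =
  concatMap (λ ℓ → map (ℓ ∷_) (tilingsFuel k f (suc n ∸ ℓ)))
            (filter (λ ℓ → ℓ ≤? suc n) (map suc (upTo k)))

tilings : (k n : ℕ) → List (List ℕ)
tilings k n = tilingsFuel k n n

-- A monomial of ℤ[q] is given by its coefficient c ∈ ℤ and exponent e ∈ ℕ.
Monomial : Set
Monomial = ℤ × ℕ

module Weighted {c ℓ : Level} (R : CommutativeRing c ℓ) where
  open CommutativeRing R

  natR : ℕ → Carrier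
  natR zero    = 0#
  natR (suc n) = 1# + natR n

  intR : ℤ → Carrier
  intR (+ n)     = natR n
  intR -[1+ n ]  = - natR (suc n)

  pow : Carrier → ℕ → Carrier
  pow x zero    = 1#
  pow x (suc e) = x * pow x e

  evalMono : Carrier → Monomial → Carrier
  evalMono q (c , e) = intR c * pow q e

  sumList : List Carrier → Carrier
  sumList = foldr _+_ 0#

  prodList : List Carrier → Carrier
  prodList = foldr _*_ 1#

  -- Σ_{i=lo}^{hi} g i  (empty, i.e. 0, if hi < lo)
  sumFromTo : ℕ → ℕ → (ℕ → Carrier) → Carrier
  sumFromTo lo hi g = sumList (map (λ t → g (lo +ℕ t)) (upTo (suc hi ∸ lo)))

  module Tiles (z : ℕ → Carrier) (q : Carrier) (f : ℕ → ℕ → ℕ → Monomial) where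

    -- weights of the tiles of a tiling of the n×1 board, with a untiled cells
    -- before and b after; s is the cell (of the n-board) where the current tile
    -- starts, so the tile of length ℓ starting in cell s is followed by
    -- τ = n − (s + ℓ − 1) cells and has weight z_ℓ f_{ℓ, a+s, b+τ}(q).
    tileWeights : (n a b s : ℕ) → List ℕ → List Carrier
    tileWeights n a b s []       = []
    tileWeights n a b s (l ∷ ls) =
      (z l * evalMono q (f l (a +ℕ s) (b +ℕ (n ∸ (s +ℕ l ∸ 1)))))
        ∷ tileWeights n a b (s +ℕ l) ls

    weight : (n a b : ℕ) → List ℕ → Carrier
    weight n a b t = prodList (tileWeights n a b 1 t)

    F : (k n a b : ℕ) → Carrier
    F k n a b = sumList (map (weight n a b) (tilings k n))

    Fℤ : (k : ℕ) → ℤ → (a b : ℕ) → Carrier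
    Fℤ k (+ n)     a b = F k n a b
    Fℤ k -[1+ n ]  a b = 0#

module Submission where

-- Write F_n[a,b] for F k n a b and w(ℓ,s,τ) = z_ℓ f_{ℓ,s,τ}(q) for the weight of
-- a single tile.  The proof is algebraic and rests on two recurrences:
--   * first tile:  F_n[a,b] = [n=0] + Σ_{ℓ=1}^k w(ℓ,a+1,b+n-ℓ) F_{n-ℓ}[a+ℓ,b],
--     read off from the enumeration of tilings by their first tile;
--   * last tile:   F_n[a,b] = [n=0] + Σ_{ℓ=1}^k F_{n-ℓ}[a,b+ℓ] w(ℓ,a+n-ℓ+1,b),
--     derived from the first one by strong induction on n (expand both ends
--     and swap the two sums).
-- All sums run over fixed ranges; F_{n-d} is replaced by a truncated version
-- 'Fdrop n d' that vanishes when d > n.  For a board of m + n cells let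
-- 'Cut m n' be the right-hand side of the theorem (split after cell m) and
-- 'Cover m n' the expansion according to the tile covering cell m+1.  The
-- first-tile recurrence gives Cover m (n+1) = Cut m (n+1), the last-tile
-- recurrence gives Cut (m+1) n = Cover m (n+1); so Cut m n only depends on
-- m + n, and Cut 0 (m+n) = F_{m+n}.

open import Defs
open import Level using (Level)
open import Data.Nat using (ℕ; zero; suc; _∸_; _≤_; _≤?_; z≤n; s≤s) renaming (_+_ to _+ℕ_)
open import Data.Nat.Tactic.RingSolver using (solve-∀)
import Data.Nat.Properties as ℕP
open import Data.Integer using (+_; _⊖_) renaming (_-_ to _-ℤ_; _+_ to _+ℤ_)
import Data.Integer.Properties as ℤP
import Data.Integer.Tactic.RingSolver as ℤSolver
open import Data.List using (List; []; _∷_; map; concatMap; filter; upTo; applyUpTo; _++_)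
open import Data.Empty using (⊥-elim)
open import Algebra.Bundles using (CommutativeRing)
import Algebra.Properties.CommutativeSemigroup as CommutativeSemigroupProperties
open import Relation.Binary.PropositionalEquality as ≡ using (_≡_)
open import Relation.Nullary using (yes; no; ¬_)
open import Relation.Unary using (Pred; Decidable)

module FiniteSums {c ℓ : Level} (R : CommutativeRing c ℓ) where
  open CommutativeRing R hiding (zero)
  open Weighted R using (sumList; sumFromTo)
  open CommutativeSemigroupProperties +-commutativeSemigroup using (interchange)
  open import Relation.Binary.Reasoning.Setoid setoid

  ∑ : ℕ → (ℕ → Carrier) → Carrier
  ∑ zero    g = 0#
  ∑ (suc n) g = g 0 + ∑ n (λ t → g (suc t))

  ∑-cong : ∀ n {g h : ℕ → Carrier} → (∀ t → g t ≈ h t) → ∑ n g ≈ ∑ n h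
  ∑-cong zero    e = refl
  ∑-cong (suc n) e = +-cong (e 0) (∑-cong n (λ t → e (suc t)))

  ∑-zero : ∀ n {g : ℕ → Carrier} → (∀ t → g t ≈ 0#) → ∑ n g ≈ 0#
  ∑-zero zero    e = refl
  ∑-zero (suc n) e = trans (+-cong (e 0) (∑-zero n (λ t → e (suc t)))) (+-identityʳ 0#)

  ∑-+ : ∀ n (g h : ℕ → Carrier) → ∑ n (λ t → g t + h t) ≈ ∑ n g + ∑ n h
  ∑-+ zero    g h = sym (+-identityʳ 0#)
  ∑-+ (suc n) g h = trans (+-congˡ (∑-+ n _ _)) (interchange _ _ _ _)

  ∑-*ˡ : ∀ n x (g : ℕ → Carrier) → x * ∑ n g ≈ ∑ n (λ t → x * g t)
  ∑-*ˡ zero    x g = zeroʳ x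
  ∑-*ˡ (suc n) x g = trans (distribˡ x _ _) (+-congˡ (∑-*ˡ n x _))

  ∑-*ʳ : ∀ n x (g : ℕ → Carrier) → ∑ n g * x ≈ ∑ n (λ t → g t * x)
  ∑-*ʳ zero    x g = zeroˡ x
  ∑-*ʳ (suc n) x g = trans (distribʳ x _ _) (+-congˡ (∑-*ʳ n x _))

  ∑-swap : ∀ n m (g : ℕ → ℕ → Carrier) →
    ∑ n (λ i → ∑ m (λ j → g i j)) ≈ ∑ m (λ j → ∑ n (λ i → g i j))
  ∑-swap zero    m g = sym (∑-zero m (λ _ → refl))
  ∑-swap (suc n) m g = begin
    ∑ m (g 0) + ∑ n (λ i → ∑ m (g (suc i)))
      ≈⟨ +-congˡ (∑-swap n m (λ i → g (suc i))) ⟩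
    ∑ m (g 0) + ∑ m (λ j → ∑ n (λ i → g (suc i) j))
      ≈⟨ ∑-+ m _ _ ⟨
    ∑ m (λ j → ∑ (suc n) (λ i → g i j)) ∎

  ∑-last : ∀ n (g : ℕ → Carrier) → ∑ (suc n) g ≈ ∑ n g + g n
  ∑-last zero    g = trans (+-identityʳ _) (sym (+-identityˡ _))
  ∑-last (suc n) g = trans (+-congˡ (∑-last n _)) (sym (+-assoc _ _ _))

  -- in a triangular double sum the row t = 0 is empty
  ∑-triangle : ∀ n (g : ℕ → ℕ → Carrier) →
    ∑ n (λ t → ∑ t (g t)) ≈ ∑ (n ∸ 1) (λ t → ∑ (suc t) (g (suc t)))
  ∑-triangle zero    g = refl
  ∑-triangle (suc n) g = +-identityˡ _

  ∑-*ˡ-split : ∀ n m (x y : ℕ → Carrier) (g : ℕ → ℕ → Carrier) →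
    ∑ n (λ t → x t * (y t + ∑ m (g t)))
      ≈ ∑ n (λ t → x t * y t) + ∑ n (λ t → ∑ m (λ u → x t * g t u))
  ∑-*ˡ-split n m x y g =
    trans (∑-cong n (λ t → trans (distribˡ _ _ _) (+-congˡ (∑-*ˡ m _ _)))) (∑-+ n _ _)

  ∑-*ʳ-split : ∀ n m (x y : ℕ → Carrier) (g : ℕ → ℕ → Carrier) →
    ∑ n (λ u → (y u + ∑ m (g u)) * x u)
      ≈ ∑ n (λ u → y u * x u) + ∑ n (λ u → ∑ m (λ t → g u t * x u))
  ∑-*ʳ-split n m x y g =
    trans (∑-cong n (λ u → trans (distribʳ _ _ _) (+-congˡ (∑-*ʳ m _ _)))) (∑-+ n _ _)

  sumList-++ : ∀ {A : Set} (h : A → Carrier) xs ys →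
    sumList (map h (xs ++ ys)) ≈ sumList (map h xs) + sumList (map h ys)
  sumList-++ h []       ys = sym (+-identityˡ _)
  sumList-++ h (x ∷ xs) ys = trans (+-congˡ (sumList-++ h xs ys)) (sym (+-assoc _ _ _))

  sumList-concatMap : ∀ {A B : Set} (h : B → Carrier) (g : A → List B) xs →
    sumList (map h (concatMap g xs)) ≈ sumList (map (λ x → sumList (map h (g x))) xs)
  sumList-concatMap h g []       = refl
  sumList-concatMap h g (x ∷ xs) =
    trans (sumList-++ h (g x) (concatMap g xs)) (+-congˡ (sumList-concatMap h g xs))

  sumList-applyUpTo : ∀ n (h : ℕ → Carrier) (e : ℕ → ℕ) →
    sumList (map h (applyUpTo e n)) ≈ ∑ n (λ t → h (e t))
  sumList-applyUpTo zero    h e = refl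
  sumList-applyUpTo (suc n) h e = +-congˡ (sumList-applyUpTo n h (λ t → e (suc t)))

  sumFromTo≈∑ : ∀ lo hi g → sumFromTo lo hi g ≈ ∑ (suc hi ∸ lo) (λ t → g (lo +ℕ t))
  sumFromTo≈∑ lo hi g = sumList-applyUpTo (suc hi ∸ lo) _ (λ t → t)

  sumList-filter-suc : ∀ {p} {Q : Pred ℕ p} (Q? : Decidable Q) (G H : ℕ → Carrier) ys →
    (∀ t → Q (suc t) → G (suc t) ≈ H (suc t)) → (∀ t → ¬ Q (suc t) → H (suc t) ≈ 0#) →
    sumList (map G (filter Q? (map suc ys))) ≈ sumList (map (λ t → H (suc t)) ys)
  sumList-filter-suc Q? G H []       kept dropped = refl
  sumList-filter-suc Q? G H (y ∷ ys) kept dropped with Q? (suc y)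
  ... | yes q  = +-cong (kept y q) (sumList-filter-suc Q? G H ys kept dropped)
  ... | no ¬q  = trans (sumList-filter-suc Q? G H ys kept dropped)
                       (trans (sym (+-identityˡ _)) (+-congʳ (sym (dropped y ¬q))))

module TilingEnumeration (k : ℕ) where

  concatMap-filter-suc-cong : ∀ {p} {Q : Pred ℕ p} (Q? : Decidable Q) ys
    (g h : ℕ → List (List ℕ)) → (∀ t → g (suc t) ≡ h (suc t)) →
    concatMap g (filter Q? (map suc ys)) ≡ concatMap h (filter Q? (map suc ys))
  concatMap-filter-suc-cong Q? []       g h e = ≡.refl
  concatMap-filter-suc-cong Q? (y ∷ ys) g h e with Q? (suc y)
  ... | yes _ = ≡.cong₂ _++_ (e y) (concatMap-filter-suc-cong Q? ys g h e)
  ... | no _  = concatMap-filter-suc-cong Q? ys g h e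

  tilingsFuel-suc : ∀ fuel n → n ≤ fuel → tilingsFuel k (suc fuel) n ≡ tilingsFuel k fuel n
  tilingsFuel-suc fuel       zero    _         = ≡.refl
  tilingsFuel-suc (suc fuel) (suc n) (s≤s n≤f) =
    concatMap-filter-suc-cong (λ ℓ → ℓ ≤? suc n) (upTo k) _ _ (λ t →
      ≡.cong (map (suc t ∷_))
             (tilingsFuel-suc fuel (n ∸ t) (ℕP.≤-trans (ℕP.m∸n≤m n t) n≤f)))

  tilingsFuel-plus : ∀ d n → tilingsFuel k (d +ℕ n) n ≡ tilings k n
  tilingsFuel-plus zero    n = ≡.refl
  tilingsFuel-plus (suc d) n =
    ≡.trans (tilingsFuel-suc (d +ℕ n) n (ℕP.m≤n+m n d)) (tilingsFuel-plus d n)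

  tilingsFuel-enough : ∀ fuel n → n ≤ fuel → tilingsFuel k fuel n ≡ tilings k n
  tilingsFuel-enough fuel n n≤f =
    ≡.trans (≡.cong (λ x → tilingsFuel k x n) (≡.sym (ℕP.m∸n+n≡m n≤f)))
            (tilingsFuel-plus (fuel ∸ n) n)

+-rotate : ∀ a s l → a +ℕ (s +ℕ l) ≡ (a +ℕ l) +ℕ s
+-rotate = solve-∀

+-exchange : ∀ s l l' → s +ℕ l +ℕ l' ≡ l +ℕ (s +ℕ l')
+-exchange = solve-∀

+-swapʳ : ∀ s l l' → s +ℕ l +ℕ l' ≡ (s +ℕ l') +ℕ l
+-swapʳ = solve-∀

module Recurrences {c ℓ : Level} (R : CommutativeRing c ℓ) (k : ℕ)
  (z : ℕ → CommutativeRing.Carrier R) (q : CommutativeRing.Carrier R)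
  (f : ℕ → ℕ → ℕ → Monomial) where
  open CommutativeRing R hiding (zero)
  open Weighted R
  open Tiles z q f
  open FiniteSums R
  open TilingEnumeration k using (tilingsFuel-enough)
  open import Relation.Binary.Reasoning.Setoid setoid

  w : ℕ → ℕ → ℕ → Carrier
  w ℓ s τ = z ℓ * evalMono q (f ℓ s τ)

  -- Removing the first tile (length l) of an n-board turns the remaining tiles
  -- into tiles of an (n - l)-board with l more untiled cells in front.
  tileWeights-shift : ∀ n a b l ls s → 1 ≤ s →
    tileWeights n a b (s +ℕ l) ls ≡ tileWeights (n ∸ l) (a +ℕ l) b s ls
  tileWeights-shift n a b l []        s       _ = ≡.refl
  tileWeights-shift n a b l (l' ∷ ls) (suc s) _ = ≡.cong₂ _∷_ head tail
    where
      after : n ∸ (s +ℕ l +ℕ l') ≡ (n ∸ l) ∸ (s +ℕ l')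
      after = ≡.trans (≡.cong (n ∸_) (+-exchange s l l')) (≡.sym (ℕP.∸-+-assoc n l (s +ℕ l')))
      head = ≡.cong₂ (λ x y → z l' * evalMono q (f l' x (b +ℕ y))) (+-rotate a (suc s) l) after
      tail = ≡.trans (≡.cong (λ x → tileWeights n a b x ls) (+-swapʳ (suc s) l l'))
                     (tileWeights-shift n a b l ls (suc s +ℕ l') (s≤s z≤n))

  weight-∷ : ∀ n a b l t →
    weight n a b (l ∷ t) ≡ w l (a +ℕ 1) (b +ℕ (n ∸ l)) * weight (n ∸ l) (a +ℕ l) b t
  weight-∷ n a b l t =
    ≡.cong (λ x → w l (a +ℕ 1) (b +ℕ (n ∸ l)) * prodList x) (tileWeights-shift n a b l t 1 (s≤s z≤n))

  sumList-weight-∷ : ∀ n a b l ts →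
    sumList (map (weight n a b) (map (l ∷_) ts))
      ≈ w l (a +ℕ 1) (b +ℕ (n ∸ l)) * sumList (map (weight (n ∸ l) (a +ℕ l) b) ts)
  sumList-weight-∷ n a b l []       = sym (zeroʳ _)
  sumList-weight-∷ n a b l (t ∷ ts) =
    trans (+-cong (reflexive (weight-∷ n a b l t)) (sumList-weight-∷ n a b l ts)) (sym (distribˡ _ _ _))

  Fdrop : ℕ → ℕ → ℕ → ℕ → Carrier
  Fdrop n       zero    a b = F k n a b
  Fdrop zero    (suc d) a b = 0#
  Fdrop (suc n) (suc d) a b = Fdrop n d a b

  δ : ℕ → ℕ → Carrier
  δ zero    zero    = 1#
  δ zero    (suc _) = 0#
  δ (suc n) zero    = 0#
  δ (suc n) (suc d) = δ n d

  Fdrop-≤ : ∀ n d a b → d ≤ n → Fdrop n d a b ≡ F k (n ∸ d) a b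
  Fdrop-≤ n       zero    a b _         = ≡.refl
  Fdrop-≤ (suc n) (suc d) a b (s≤s d≤n) = Fdrop-≤ n d a b d≤n

  Fdrop-> : ∀ n d a b → ¬ d ≤ n → Fdrop n d a b ≡ 0#
  Fdrop-> n       zero    a b d≰n = ⊥-elim (d≰n z≤n)
  Fdrop-> zero    (suc d) a b d≰n = ≡.refl
  Fdrop-> (suc n) (suc d) a b d≰n = Fdrop-> n d a b (λ d≤n → d≰n (s≤s d≤n))

  Fdrop-+ : ∀ n i d a b → i ≤ n → Fdrop n (i +ℕ d) a b ≡ Fdrop (n ∸ i) d a b
  Fdrop-+ n       zero    d a b _         = ≡.refl
  Fdrop-+ (suc n) (suc i) d a b (s≤s i≤n) = Fdrop-+ n i d a b i≤n

  δ-≤ : ∀ n d → d ≤ n → δ n d ≡ δ (n ∸ d) 0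
  δ-≤ zero    zero    _         = ≡.refl
  δ-≤ (suc n) zero    _         = ≡.refl
  δ-≤ (suc n) (suc d) (s≤s d≤n) = δ-≤ n d d≤n

  δ-> : ∀ n d → ¬ d ≤ n → δ n d ≡ 0#
  δ-> n       zero    d≰n = ⊥-elim (d≰n z≤n)
  δ-> zero    (suc d) d≰n = ≡.refl
  δ-> (suc n) (suc d) d≰n = δ-> n d (λ d≤n → d≰n (s≤s d≤n))

  -- X and Y only need to agree in the case d = n, the only one where δ n d ≠ 0
  δ-mask : ∀ n d X Y → (d ≡ n → X ≈ Y) → X * δ n d ≈ δ n d * Y
  δ-mask zero    zero    X Y e = trans (*-identityʳ X) (trans (e ≡.refl) (sym (*-identityˡ Y)))
  δ-mask zero    (suc d) X Y e = trans (zeroʳ X) (sym (zeroˡ Y))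
  δ-mask (suc n) zero    X Y e = trans (zeroʳ X) (sym (zeroˡ Y))
  δ-mask (suc n) (suc d) X Y e = δ-mask n d X Y (λ d≡n → e (≡.cong suc d≡n))

  -- likewise, the factors around Fdrop n d only need to agree when d ≤ n
  Fdrop-mask : ∀ n d a b X X' Y Y' → (d ≤ n → X ≈ X') → (d ≤ n → Y ≈ Y') →
    X * (Fdrop n d a b * Y) ≈ (X' * Fdrop n d a b) * Y'
  Fdrop-mask n d a b X X' Y Y' eX eY with d ≤? n
  ... | yes d≤n = trans (sym (*-assoc X _ Y)) (*-cong (*-congʳ (eX d≤n)) (eY d≤n))
  ... | no  d≰n = begin
      X * (Fdrop n d a b * Y)    ≈⟨ *-congˡ (*-congʳ (reflexive (Fdrop-> n d a b d≰n))) ⟩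
      X * (0# * Y)               ≈⟨ trans (*-congˡ (zeroˡ Y)) (zeroʳ X) ⟩
      0#                         ≈⟨ trans (sym (zeroˡ Y')) (*-congʳ (sym (zeroʳ X'))) ⟩
      (X' * 0#) * Y'             ≈⟨ *-congʳ (*-congˡ (reflexive (≡.sym (Fdrop-> n d a b d≰n)))) ⟩
      (X' * Fdrop n d a b) * Y'  ∎

  F-empty : ∀ a b → F k 0 a b ≈ 1#
  F-empty a b = +-identityʳ 1#

  -- First-tile recurrence: classify tilings by the length ℓ = t+1 of their first tile.
  firstTile : ∀ n a b → F k n a b ≈
    δ n 0 + ∑ k (λ t → w (suc t) (a +ℕ 1) (b +ℕ (n ∸ suc t)) * Fdrop n (suc t) (a +ℕ suc t) b)
  firstTile zero a b =
    trans (F-empty a b) (trans (sym (+-identityʳ 1#)) (+-congˡ (sym (∑-zero k (λ t → zeroʳ _)))))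
  firstTile (suc n) a b = begin
    F k (suc n) a b
      ≈⟨ sumList-concatMap (weight (suc n) a b) startingWith lengths ⟩
    sumList (map (λ ℓ → sumList (map (weight (suc n) a b) (startingWith ℓ))) lengths)
      ≈⟨ sumList-filter-suc (λ ℓ → ℓ ≤? suc n) _ H (upTo k) fits doesNotFit ⟩
    sumList (map (λ t → H (suc t)) (upTo k))
      ≈⟨ sumList-applyUpTo k (λ t → H (suc t)) (λ t → t) ⟩
    ∑ k (λ t → H (suc t))
      ≈⟨ +-identityˡ _ ⟨
    0# + ∑ k (λ t → H (suc t)) ∎
    where
      startingWith : ℕ → List (List ℕ)
      startingWith ℓ = map (ℓ ∷_) (tilingsFuel k n (suc n ∸ ℓ))
      lengths : List ℕ
      lengths = filter (λ ℓ → ℓ ≤? suc n) (map suc (upTo k))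
      H : ℕ → Carrier
      H ℓ = w ℓ (a +ℕ 1) (b +ℕ (suc n ∸ ℓ)) * Fdrop (suc n) ℓ (a +ℕ ℓ) b
      fits : ∀ t → suc t ≤ suc n → sumList (map (weight (suc n) a b) (startingWith (suc t))) ≈ H (suc t)
      fits t (s≤s t≤n) =
        trans (sumList-weight-∷ (suc n) a b (suc t) (tilingsFuel k n (n ∸ t)))
              (*-congˡ (reflexive (≡.trans
                 (≡.cong (λ ts → sumList (map (weight (n ∸ t) (a +ℕ suc t) b) ts))
                         (tilingsFuel-enough n (n ∸ t) (ℕP.m∸n≤m n t)))
                 (≡.sym (Fdrop-≤ n t (a +ℕ suc t) b t≤n)))))
      doesNotFit : ∀ t → ¬ suc t ≤ suc n → H (suc t) ≈ 0#
      doesNotFit t t≰n = trans (*-congˡ (reflexive (Fdrop-> (suc n) (suc t) _ b t≰n))) (zeroʳ _)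

  firstTile-drop : ∀ n i a b → Fdrop n i a b ≈
    δ n i + ∑ k (λ t → w (suc t) (a +ℕ 1) (b +ℕ ((n ∸ i) ∸ suc t)) * Fdrop n (i +ℕ suc t) (a +ℕ suc t) b)
  firstTile-drop n i a b with i ≤? n
  ... | yes i≤n = begin
      Fdrop n i a b     ≈⟨ reflexive (Fdrop-≤ n i a b i≤n) ⟩
      F k (n ∸ i) a b   ≈⟨ firstTile (n ∸ i) a b ⟩
      _                 ≈⟨ +-cong (reflexive (≡.sym (δ-≤ n i i≤n))) (∑-cong k (λ t →
                             *-congˡ (reflexive (≡.sym (Fdrop-+ n i (suc t) _ b i≤n))))) ⟩
      _                 ∎
  ... | no i≰n = begin
      Fdrop n i a b     ≈⟨ reflexive (Fdrop-> n i a b i≰n) ⟩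
      0#                ≈⟨ +-identityʳ 0# ⟨
      0# + 0#           ≈⟨ +-cong (reflexive (≡.sym (δ-> n i i≰n))) (sym (∑-zero k (λ t →
                             trans (*-congˡ (reflexive (Fdrop-> n (i +ℕ suc t) _ b
                                     (λ le → i≰n (ℕP.m+n≤o⇒m≤o i le)))))
                                   (zeroʳ _)))) ⟩
      _                 ∎

  -- Last-tile recurrence for boards of length n (the length of the last tile is t+1).
  LastTile : ℕ → Set ℓ
  LastTile n = ∀ a b → F k n a b ≈
    δ n 0 + ∑ k (λ t → Fdrop n (suc t) a (b +ℕ suc t) * w (suc t) (suc (a +ℕ (n ∸ suc t))) b)

  lastTile-drop : ∀ n l a b → (l ≤ n → LastTile (n ∸ l)) → Fdrop n l a b ≈
    δ n l + ∑ k (λ t → Fdrop n (l +ℕ suc t) a (b +ℕ suc t) * w (suc t) (suc (a +ℕ ((n ∸ l) ∸ suc t))) b)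
  lastTile-drop n l a b ih with l ≤? n
  ... | yes l≤n = begin
      Fdrop n l a b     ≈⟨ reflexive (Fdrop-≤ n l a b l≤n) ⟩
      F k (n ∸ l) a b   ≈⟨ ih l≤n a b ⟩
      _                 ≈⟨ +-cong (reflexive (≡.sym (δ-≤ n l l≤n))) (∑-cong k (λ t →
                             *-congʳ (reflexive (≡.sym (Fdrop-+ n l (suc t) a _ l≤n))))) ⟩
      _                 ∎
  ... | no l≰n = begin
      Fdrop n l a b     ≈⟨ reflexive (Fdrop-> n l a b l≰n) ⟩
      0#                ≈⟨ +-identityʳ 0# ⟨
      0# + 0#           ≈⟨ +-cong (reflexive (≡.sym (δ-> n l l≰n))) (sym (∑-zero k (λ t →
                             trans (*-congʳ (reflexive (Fdrop-> n (l +ℕ suc t) a _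
                                     (λ le → l≰n (ℕP.m+n≤o⇒m≤o l le)))))
                                   (zeroˡ _)))) ⟩
      _                 ∎

  private
    split : ∀ {n} l i → l +ℕ i ≤ n → n ≡ l +ℕ i +ℕ (n ∸ (l +ℕ i))
    split {n} l i l+i≤n = ≡.sym (ℕP.m+[n∸m]≡n l+i≤n)

    drop-l : ∀ l i r → (l +ℕ i +ℕ r) ∸ l ≡ i +ℕ r
    drop-l l i r = ≡.trans (≡.cong (_∸ l) (ℕP.+-assoc l i r)) (ℕP.m+n∸m≡n l (i +ℕ r))

    drop-i : ∀ l i r → (l +ℕ i +ℕ r) ∸ i ≡ l +ℕ r
    drop-i l i r = ≡.trans (≡.cong (_∸ i) (+-exchange l i r)) (ℕP.m+n∸m≡n i (l +ℕ r))

  cellsAfter-first : ∀ b l i n → l +ℕ i ≤ n → b +ℕ (n ∸ l) ≡ (b +ℕ i) +ℕ ((n ∸ i) ∸ l)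
  cellsAfter-first b l i n le rewrite split l i le
    | drop-l l i (n ∸ (l +ℕ i)) | drop-i l i (n ∸ (l +ℕ i)) | ℕP.m+n∸m≡n l (n ∸ (l +ℕ i)) =
    ≡.sym (ℕP.+-assoc b i _)

  cellsBefore-last : ∀ a l i n → l +ℕ i ≤ n → (a +ℕ l) +ℕ ((n ∸ l) ∸ i) ≡ a +ℕ (n ∸ i)
  cellsBefore-last a l i n le rewrite split l i le
    | drop-l l i (n ∸ (l +ℕ i)) | drop-i l i (n ∸ (l +ℕ i)) | ℕP.m+n∸m≡n i (n ∸ (l +ℕ i)) =
    ℕP.+-assoc a l _

  lastTile-empty : LastTile 0
  lastTile-empty a b =
    trans (F-empty a b) (trans (sym (+-identityʳ 1#)) (+-congˡ (sym (∑-zero k (λ t → zeroˡ _)))))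

  -- Strong induction (n ≤ N): expand by the first tile, expand each remainder by
  -- its last tile, swap the two sums and fold the first-tile expansions back up.
  lastTile≤ : ∀ N n → n ≤ N → LastTile n
  lastTile≤ N       zero    _         = lastTile-empty
  lastTile≤ (suc N) (suc n) (s≤s n≤N) a b = begin
    F k n' a b
      ≈⟨ firstTile n' a b ⟩
    δ n' 0 + ∑ k (λ t → W t * Fdrop n' (suc t) (a +ℕ suc t) b)
      ≈⟨ +-congˡ (∑-cong k (λ t → *-congˡ (lastTile-drop n' (suc t) (a +ℕ suc t) b
            (λ _ → lastTile≤ N (n ∸ t) (ℕP.≤-trans (ℕP.m∸n≤m n t) n≤N))))) ⟩
    δ n' 0 + ∑ k (λ t → W t * (δ n' (suc t) + ∑ k (λ u → Fboth t u * V t u)))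
      ≈⟨ +-congˡ (∑-*ˡ-split k k W (λ t → δ n' (suc t)) (λ t u → Fboth t u * V t u)) ⟩
    δ n' 0 + (∑ k (λ t → W t * δ n' (suc t)) + ∑ k (λ t → ∑ k (λ u → W t * (Fboth t u * V t u))))
      ≈⟨ +-congˡ (+-cong (∑-cong k single)
                         (trans (∑-swap k k _) (∑-cong k (λ u → ∑-cong k (λ t → both t u))))) ⟩
    δ n' 0 + (∑ k (λ u → δ n' (suc u) * U u) + ∑ k (λ u → ∑ k (λ t → (W' u t * Fboth' u t) * U u)))
      ≈⟨ +-congˡ (∑-*ʳ-split k k U (λ u → δ n' (suc u)) W*Fboth') ⟨
    δ n' 0 + ∑ k (λ u → (δ n' (suc u) + ∑ k (W*Fboth' u)) * U u)
      ≈⟨ +-congˡ (∑-cong k (λ u → *-congʳ (sym (firstTile-drop n' (suc u) a (b +ℕ suc u))))) ⟩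
    δ n' 0 + ∑ k (λ u → Fdrop n' (suc u) a (b +ℕ suc u) * U u) ∎
    where
      n' = suc n
      -- first tile of length t+1, last tile of length u+1, in both orders of expansion
      W : ℕ → Carrier
      W t = w (suc t) (a +ℕ 1) (b +ℕ (n' ∸ suc t))
      W' : ℕ → ℕ → Carrier
      W' u t = w (suc t) (a +ℕ 1) ((b +ℕ suc u) +ℕ ((n' ∸ suc u) ∸ suc t))
      V : ℕ → ℕ → Carrier
      V t u = w (suc u) (suc ((a +ℕ suc t) +ℕ ((n' ∸ suc t) ∸ suc u))) b
      U : ℕ → Carrier
      U u = w (suc u) (suc (a +ℕ (n' ∸ suc u))) b
      Fboth : ℕ → ℕ → Carrier
      Fboth t u = Fdrop n' (suc t +ℕ suc u) (a +ℕ suc t) (b +ℕ suc u)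
      Fboth' : ℕ → ℕ → Carrier
      Fboth' u t = Fdrop n' (suc u +ℕ suc t) (a +ℕ suc t) (b +ℕ suc u)
      W*Fboth' : ℕ → ℕ → Carrier
      W*Fboth' u t = W' u t * Fboth' u t
      -- a single tile covering the whole board
      single : ∀ t → W t * δ n' (suc t) ≈ δ n' (suc t) * U t
      single t = δ-mask n' (suc t) (W t) (U t) (λ t+1≡n' →
        let nothingLeft = ≡.trans (≡.cong (n' ∸_) t+1≡n') (ℕP.n∸n≡0 n') in
        reflexive (≡.cong₂ (w (suc t))
          (≡.trans (ℕP.+-comm a 1)
                   (≡.cong suc (≡.trans (≡.sym (ℕP.+-identityʳ a)) (≡.cong (a +ℕ_) (≡.sym nothingLeft)))))
          (≡.trans (≡.cong (b +ℕ_) nothingLeft) (ℕP.+-identityʳ b))))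
      -- two distinct end tiles
      both : ∀ t u → W t * (Fboth t u * V t u) ≈ (W' u t * Fboth' u t) * U u
      both t u =
        trans (*-congˡ (*-congʳ (reflexive (≡.cong (λ d → Fdrop n' d (a +ℕ suc t) (b +ℕ suc u))
                                                     (ℕP.+-comm (suc t) (suc u))))))
              (Fdrop-mask n' (suc u +ℕ suc t) _ _ _ _ _ _
                (λ le → reflexive (≡.cong (w (suc t) (a +ℕ 1))
                                          (cellsAfter-first b (suc t) (suc u) n' (fits le))))
                (λ le → reflexive (≡.cong (λ x → w (suc u) (suc x) b)
                                          (cellsBefore-last a (suc t) (suc u) n' (fits le)))))
        where
          fits : suc u +ℕ suc t ≤ n' → suc t +ℕ suc u ≤ n'
          fits = ≡.subst (_≤ n') (ℕP.+-comm (suc u) (suc t))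

  lastTile : ∀ n → LastTile n
  lastTile n = lastTile≤ n n ℕP.≤-refl

  -- Contribution of a tile of length i having j of its cells among the first m
  -- cells of a board of m + n cells (so N = n + j cells lie from the tile on).
  crossingAt : ℕ → ℕ → ℕ → ℕ → Carrier
  crossingAt i j m N = (w i (suc (m ∸ j)) (N ∸ i) * Fdrop m j 0 N) * Fdrop N i ((m +ℕ i) ∸ j) 0

  crossing : ℕ → ℕ → ℕ → ℕ → Carrier
  crossing i j m n = crossingAt i j m (n +ℕ j)

  straddling : ℕ → ℕ → Carrier
  straddling m n = ∑ (k ∸ 1) (λ t → ∑ (suc t) (λ u → crossing (2 +ℕ t) (1 +ℕ u) m n))

  Cut : ℕ → ℕ → Carrier
  Cut m n = F k m 0 n * F k n m 0 + straddling m n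

  -- expansion by the tile covering cell m + 1 (length t+1, with j ≤ t cells before it)
  Cover : ℕ → ℕ → Carrier
  Cover m n = ∑ k (λ t → ∑ (suc t) (λ j → crossing (suc t) j m n))

  -- j = 0: the covering tile is the first tile to the right of the cut
  crossing-right : ∀ i m n →
    crossing i 0 m n ≈ F k m 0 n * (w i (m +ℕ 1) (0 +ℕ (n ∸ i)) * Fdrop n i (m +ℕ i) 0)
  crossing-right i m n rewrite ℕP.+-identityʳ n | ℕP.+-comm m 1 =
    trans (*-congʳ (*-comm _ _)) (*-assoc _ _ _)

  -- j = i - 1 on a board with one cell moved to the right of the cut: the
  -- covering tile is the last tile to the left of cell m + 2
  crossing-left : ∀ t m n →
    crossing (suc t) t m (suc n) ≈ (Fdrop m t 0 (n +ℕ suc t) * w (suc t) (suc (m ∸ t)) n) * F k n (suc m) 0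
  crossing-left t m n = begin
    crossing (suc t) t m (suc n)
      ≈⟨ reflexive (≡.cong (crossingAt (suc t) t m) (≡.sym (ℕP.+-suc n t))) ⟩
    (w (suc t) (suc (m ∸ t)) ((n +ℕ suc t) ∸ suc t) * Fdrop m t 0 (n +ℕ suc t))
       * Fdrop (n +ℕ suc t) (suc t) ((m +ℕ suc t) ∸ t) 0
      ≈⟨ *-cong (*-congʳ (reflexive (≡.cong (w (suc t) (suc (m ∸ t))) (ℕP.m+n∸n≡m n (suc t)))))
                (reflexive (≡.trans (Fdrop-≤ (n +ℕ suc t) (suc t) _ 0 (ℕP.m≤n+m (suc t) n))
                   (≡.cong₂ (λ x y → F k x y 0) (ℕP.m+n∸n≡m n (suc t))
                      (≡.trans (≡.cong (_∸ t) (ℕP.+-suc m t)) (ℕP.m+n∸n≡m (suc m) t))))) ⟩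
    (w (suc t) (suc (m ∸ t)) n * Fdrop m t 0 (n +ℕ suc t)) * F k n (suc m) 0
      ≈⟨ *-congʳ (*-comm _ _) ⟩
    (Fdrop m t 0 (n +ℕ suc t) * w (suc t) (suc (m ∸ t)) n) * F k n (suc m) 0 ∎

  -- First-tile recurrence for F_{n+1}[m,0] collects the j = 0 terms of Cover.
  cover≈cut : ∀ m n → Cover m (suc n) ≈ Cut m (suc n)
  cover≈cut m n = begin
    Cover m n'
      ≈⟨ ∑-+ k (λ t → crossing (suc t) 0 m n') (λ t → ∑ t (λ j → crossing (suc t) (suc j) m n')) ⟩
    ∑ k (λ t → crossing (suc t) 0 m n') + ∑ k (λ t → ∑ t (λ j → crossing (suc t) (suc j) m n'))
      ≈⟨ +-cong (∑-cong k (λ t → crossing-right (suc t) m n'))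
                (∑-triangle k (λ t j → crossing (suc t) (suc j) m n')) ⟩
    ∑ k (λ t → F k m 0 n' * (w (suc t) (m +ℕ 1) (0 +ℕ (n' ∸ suc t)) * Fdrop n' (suc t) (m +ℕ suc t) 0))
      + straddling m n'
      ≈⟨ +-congʳ (∑-*ˡ k _ _) ⟨
    F k m 0 n' * ∑ k (λ t → w (suc t) (m +ℕ 1) (0 +ℕ (n' ∸ suc t)) * Fdrop n' (suc t) (m +ℕ suc t) 0)
      + straddling m n'
      ≈⟨ +-congʳ (*-congˡ (trans (sym (+-identityˡ _)) (sym (firstTile n' m 0)))) ⟩
    Cut m n' ∎
    where n' = suc n

  -- Last-tile recurrence for F_{m+1}[0,n] supplies the j = i - 1 terms of Cover.
  cut≈cover : ∀ m n → Cut (suc m) n ≈ Cover m (suc n)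
  cut≈cover m n = begin
    F k (suc m) 0 n * F k n (suc m) 0 + straddling (suc m) n
      ≈⟨ +-cong (*-congʳ (lastTile (suc m) 0 n)) (∑-cong (k ∸ 1) (λ t → ∑-cong (suc t) (λ u →
            reflexive (≡.cong (crossingAt (2 +ℕ t) u m) (ℕP.+-suc n u))))) ⟩
    (0# + ∑ k (λ t → Fdrop m t 0 (n +ℕ suc t) * w (suc t) (suc (m ∸ t)) n)) * F k n (suc m) 0
      + ∑ (k ∸ 1) (λ t → ∑ (suc t) (λ u → crossing (2 +ℕ t) u m n'))
      ≈⟨ +-cong (trans (*-congʳ (+-identityˡ _))
                       (trans (∑-*ʳ k _ _) (∑-cong k (λ t → sym (crossing-left t m n)))))
                (sym (∑-triangle k (λ t j → crossing (suc t) j m n'))) ⟩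
    ∑ k (λ t → crossing (suc t) t m n') + ∑ k (λ t → ∑ t (λ j → crossing (suc t) j m n'))
      ≈⟨ +-comm _ _ ⟩
    ∑ k (λ t → ∑ t (λ j → crossing (suc t) j m n')) + ∑ k (λ t → crossing (suc t) t m n')
      ≈⟨ ∑-+ k _ _ ⟨
    ∑ k (λ t → ∑ t (λ j → crossing (suc t) j m n') + crossing (suc t) t m n')
      ≈⟨ ∑-cong k (λ t → sym (∑-last t (λ j → crossing (suc t) j m n'))) ⟩
    Cover m n' ∎
    where n' = suc n

  crossing-none : ∀ i u n → crossing i (suc u) 0 n ≈ 0#
  crossing-none i u n = trans (*-congʳ (zeroʳ _)) (zeroˡ _)

  cut-start : ∀ n → Cut 0 n ≈ F k n 0 0
  cut-start n =
    trans (+-cong (trans (*-congʳ (F-empty 0 n)) (*-identityˡ _))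
                  (∑-zero (k ∸ 1) (λ t → ∑-zero (suc t) (λ u → crossing-none (2 +ℕ t) u n))))
          (+-identityʳ _)

  cut-identity : ∀ m n → F k (m +ℕ n) 0 0 ≈ Cut m n
  cut-identity zero    n = sym (cut-start n)
  cut-identity (suc m) n = begin
    F k (suc m +ℕ n) 0 0  ≈⟨ reflexive (≡.cong (λ x → F k x 0 0) (≡.sym (ℕP.+-suc m n))) ⟩
    F k (m +ℕ suc n) 0 0  ≈⟨ cut-identity m (suc n) ⟩
    Cut m (suc n)         ≈⟨ cover≈cut m n ⟨
    Cover m (suc n)       ≈⟨ cut≈cover m n ⟨
    Cut (suc m) n         ∎

  Fℤ-⊖ : ∀ m j a b → Fℤ k (m ⊖ j) a b ≡ Fdrop m j a b
  Fℤ-⊖ m       zero    a b rewrite ℤP.⊖-≥ {m} {0} z≤n = ≡.refl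
  Fℤ-⊖ zero    (suc j) a b = ≡.refl
  Fℤ-⊖ (suc m) (suc j) a b rewrite ℤP.[1+m]⊖[1+n]≡m⊖n m j = Fℤ-⊖ m j a b

  Fℤ-left : ∀ m j a b → Fℤ k (+ m -ℤ + j) a b ≡ Fdrop m j a b
  Fℤ-left m j a b rewrite ℤP.[+m]-[+n]≡m⊖n m j = Fℤ-⊖ m j a b

  Fℤ-right : ∀ n i j a b → Fℤ k ((+ n -ℤ + i) +ℤ + j) a b ≡ Fdrop (n +ℕ j) i a b
  Fℤ-right n i j a b =
    ≡.trans (≡.cong (λ x → Fℤ k x a b) (reorder (+ n) (+ i) (+ j)))
   (≡.trans (≡.cong (λ x → Fℤ k (x -ℤ + i) a b) (≡.sym (ℤP.pos-+ n j)))
            (Fℤ-left (n +ℕ j) i a b))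
    where
      reorder : ∀ x y u → (x -ℤ y) +ℤ u ≡ (x +ℤ u) -ℤ y
      reorder = ℤSolver.solve-∀

-- Theorem 2.2; the identity in fact holds without the hypotheses k, m, n ≥ 1.
theorem2p2 : {c ℓ : Level} (R : CommutativeRing c ℓ) →
    let open CommutativeRing R
        open Weighted R
    in (k : ℕ) → 1 ≤ k →
       (z : ℕ → Carrier) (q : Carrier) (f : ℕ → ℕ → ℕ → Monomial) →
       let open Tiles z q f
       in (m n : ℕ) → 1 ≤ m → 1 ≤ n →
          F k (m +ℕ n) 0 0
            ≈ (F k m 0 n * F k n m 0)
              + sumFromTo 2 k (λ i → sumFromTo 1 (i ∸ 1) (λ j →
                  ((z i * evalMono q (f i (suc (m ∸ j)) ((n +ℕ j) ∸ i)))
                    * Fℤ k (+ m -ℤ + j) 0 (n +ℕ j))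
                    * Fℤ k ((+ n -ℤ + i) +ℤ + j) ((m +ℕ i) ∸ j) 0))
theorem2p2 R k _ z q f m n _ _ = trans (cut-identity m n) (+-congˡ (sym paperSum≈straddling))
  where
    open CommutativeRing R hiding (zero)
    open Weighted R
    open Tiles z q f
    open FiniteSums R
    open Recurrences R k z q f
    term : ℕ → ℕ → Carrier
    term i j = (w i (suc (m ∸ j)) ((n +ℕ j) ∸ i) * Fℤ k (+ m -ℤ + j) 0 (n +ℕ j))
                 * Fℤ k ((+ n -ℤ + i) +ℤ + j) ((m +ℕ i) ∸ j) 0
    term≈crossing : ∀ i j → term i j ≈ crossing i j m n
    term≈crossing i j = reflexive (≡.cong₂ (λ x y → (w i (suc (m ∸ j)) ((n +ℕ j) ∸ i) * x) * y)
                                           (Fℤ-left m j 0 (n +ℕ j)) (Fℤ-right n i j _ 0))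
    paperSum≈straddling : sumFromTo 2 k (λ i → sumFromTo 1 (i ∸ 1) (term i)) ≈ straddling m n
    paperSum≈straddling =
      trans (sumFromTo≈∑ 2 k (λ i → sumFromTo 1 (i ∸ 1) (term i)))
            (∑-cong (k ∸ 1) (λ t → trans (sumFromTo≈∑ 1 (1 +ℕ t) (term (2 +ℕ t)))
                                         (∑-cong (suc t) (λ u → term≈crossing (2 +ℕ t) (1 +ℕ u)))))
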